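{- Let $\mathbf{L}=\langle L,\wedge,\vee,\to,0,1\rangle$ be a DLI$^{+}_{1}$-algebra. Then $\mathbf{L}$ is a Heyting algebra (that is, $x\wedge y\le z$ iff $x\le y\to z$ for all $x,y,z\in L$) if and only if $x\le y\to x$ for all $x,y\in L$.
   Context: A DLI-algebra is an algebra $\langle L,\wedge,\vee,\to,0,1\rangle$ such that $\langle L,\wedge,\vee,0,1\rangle$ is a bounded distributive lattice and for all $a,b,d$: $(a\to b)\wedge(a\to d)=a\to(b\wedge d)$; $(a\to d)\wedge(b\to d)=(a\vee b)\to d$; $0\to a=1$; $a\to 1=1$. A DLI$^{+}_{1}$-algebra is a DLI-algebra additionally satisfying $a\wedge(a\to b)\le b$ and $a\to a=1$ for all $a,b$. -}

module Defs where

open import Level using (Level; _⊔_; suc)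
open import Algebra.Core using (Op₂)
open import Algebra.Lattice.Structures using (IsDistributiveLattice)
open import Relation.Binary.Core using (Rel)

record DLIAlgebra c ℓ : Set (suc (c ⊔ ℓ)) where
  infixr 5 _⇒_
  infixr 7 _∧_
  infixr 6 _∨_
  infix  4 _≈_ _≤_
  field
    Carrier               : Set c
    _≈_                   : Rel Carrier ℓ
    _∨_                   : Op₂ Carrier
    _∧_                   : Op₂ Carrier
    _⇒_                   : Op₂ Carrier
    ⊥ ⊤                   : Carrier
    isDistributiveLattice : IsDistributiveLattice _≈_ _∨_ _∧_
    ⊥-least               : ∀ a → ⊥ ∧ a ≈ ⊥
    ⊤-greatest            : ∀ a → a ∧ ⊤ ≈ a
    ⇒-cong                : ∀ {a a′ b b′} → a ≈ a′ → b ≈ b′ → (a ⇒ b) ≈ (a′ ⇒ b′)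
    ⇒-∧-right             : ∀ a b d → (a ⇒ b) ∧ (a ⇒ d) ≈ a ⇒ (b ∧ d)
    ⇒-∨-left              : ∀ a b d → (a ⇒ d) ∧ (b ⇒ d) ≈ (a ∨ b) ⇒ d
    ⊥⇒                    : ∀ a → ⊥ ⇒ a ≈ ⊤
    ⇒⊤                    : ∀ a → a ⇒ ⊤ ≈ ⊤

  open IsDistributiveLattice isDistributiveLattice public

  _≤_ : Rel Carrier ℓ
  a ≤ b = a ∧ b ≈ a

record IsDLI⁺₁ {c ℓ : Level} (L : DLIAlgebra c ℓ) : Set (c ⊔ ℓ) where
  open DLIAlgebra L
  field
    modusPonens : ∀ a b → a ∧ (a ⇒ b) ≤ b
    ⇒-refl      : ∀ a → a ⇒ a ≈ ⊤

IsHeyting : {c ℓ : Level} → DLIAlgebra c ℓ → Set (c ⊔ ℓ)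
IsHeyting L = ∀ x y z → (x ∧ y ≤ z → x ≤ y ⇒ z) × (x ≤ y ⇒ z → x ∧ y ≤ z)
  where open DLIAlgebra L
        open import Data.Product using (_×_)

-- Residuation "x ∧ y ≤ z ⇔ x ≤ y ⇒ z" applied to x ∧ y ≤ x gives x ≤ y ⇒ x.
-- Conversely, if x ≤ y ⇒ x then x ≤ (y ⇒ x) ∧ (y ⇒ y) = y ⇒ (x ∧ y), so
-- x ∧ y ≤ z gives x ≤ y ⇒ z by monotonicity of y ⇒ _; and x ≤ y ⇒ z gives
-- x ∧ y ≤ y ∧ (y ⇒ z) ≤ z by modus ponens.
module Submission where

open import Defs
open import Level using (_⊔_)
open import Data.Product using (_×_; _,_; proj₁)
open import Algebra.Lattice.Bundles using (DistributiveLattice)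
import Algebra.Lattice.Properties.Lattice as LatticeProperties
import Relation.Binary.Lattice as OrderLattice

module DLIProperties {c ℓ} (L : DLIAlgebra c ℓ) where
  open DLIAlgebra L

  private
    distributiveLattice : DistributiveLattice c ℓ
    distributiveLattice = record { isDistributiveLattice = isDistributiveLattice }

    -- The library's meet-semilattice order is x ≈ x ∧ y, the symmetric
    -- form of the order x ∧ y ≈ x used by DLIAlgebra.
    module Meet = OrderLattice.MeetSemilattice
      (LatticeProperties.∧-orderTheoreticMeetSemilattice
        (DistributiveLattice.lattice distributiveLattice))

  x∧y≤x : ∀ x y → x ∧ y ≤ x
  x∧y≤x x y = sym (Meet.x∧y≤x x y)

  x∧y≤y : ∀ x y → x ∧ y ≤ y
  x∧y≤y x y = sym (Meet.x∧y≤y x y)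

  ≤-trans : ∀ {a b d} → a ≤ b → b ≤ d → a ≤ d
  ≤-trans a≤b b≤d = sym (Meet.trans (sym a≤b) (sym b≤d))

  ∧-greatest : ∀ {a b d} → a ≤ b → a ≤ d → a ≤ b ∧ d
  ∧-greatest a≤b a≤d = sym (Meet.∧-greatest (sym a≤b) (sym a≤d))

  Weakening : Set (c ⊔ ℓ)
  Weakening = ∀ x y → x ≤ y ⇒ x

  heyting⇒weakening : IsHeyting L → Weakening
  heyting⇒weakening heyting x y = proj₁ (heyting x y x) (x∧y≤x x y)

  ≤-respʳ-≈ : ∀ {a b d} → a ≤ b → b ≈ d → a ≤ d
  ≤-respʳ-≈ a≤b b≈d = trans (∧-congˡ (sym b≈d)) a≤b

  ⇒-monoʳ-≤ : ∀ y {a b} → a ≤ b → y ⇒ a ≤ y ⇒ b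
  ⇒-monoʳ-≤ y {a} {b} a≤b = trans (⇒-∧-right y a b) (⇒-cong refl a≤b)

module DLI⁺₁Properties {c ℓ} (L : DLIAlgebra c ℓ) (L⁺₁ : IsDLI⁺₁ L) where
  open DLIAlgebra L
  open IsDLI⁺₁ L⁺₁
  open DLIProperties L

  weakening⇒≤⇒∧ : Weakening → ∀ x y → x ≤ y ⇒ (x ∧ y)
  weakening⇒≤⇒∧ weakening x y =
    ≤-respʳ-≈ (∧-greatest (weakening x y) (≤-respʳ-≈ (⊤-greatest x) (sym (⇒-refl y))))
              (⇒-∧-right y x y)

  weakening⇒heyting : Weakening → IsHeyting L
  weakening⇒heyting weakening x y z = residuate , unresiduate
    where
    residuate : x ∧ y ≤ z → x ≤ y ⇒ z
    residuate x∧y≤z = ≤-trans (weakening⇒≤⇒∧ weakening x y) (⇒-monoʳ-≤ y x∧y≤z)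

    unresiduate : x ≤ y ⇒ z → x ∧ y ≤ z
    unresiduate x≤y⇒z =
      ≤-trans (∧-greatest (x∧y≤y x y) (≤-trans (x∧y≤x x y) x≤y⇒z)) (modusPonens y z)

lemma8p1 : ∀ {c ℓ} (L : DLIAlgebra c ℓ) → IsDLI⁺₁ L →
    (IsHeyting L → (∀ x y → DLIAlgebra._≤_ L x (DLIAlgebra._⇒_ L y x))) ×
    ((∀ x y → DLIAlgebra._≤_ L x (DLIAlgebra._⇒_ L y x)) → IsHeyting L)
lemma8p1 L L⁺₁ = heyting⇒weakening , weakening⇒heyting
  where open DLIProperties L
        open DLI⁺₁Properties L L⁺₁
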